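{- Let $Q$ be a better-quasi-order and let $\varphi:\mathcal{E}\to Q$ be locally constant. For every finite subset $\mathcal{G}$ of $\mathcal{E}$ there exists $h\in\mathcal{E}$ such that for every $f\in\mathcal{E}$ and every $g\in\mathcal{G}$, \[\varphi(h\circ f)\leq\varphi(h\circ f\circ g).\]
   Context: $\mathcal{E}$ is the set of strictly increasing maps $\omega\to\omega$, with the topology induced by the Baire space $\omega^{\omega}$; $\varphi$ is locally constant if it is continuous for the discrete topology on $Q$. $[\omega]^{\omega}$ denotes the infinite subsets of $\omega$, topologized as a subspace of the Cantor space. A map $h:[\omega]^{\omega}\to Q$ is locally constant if for every $Y$ there is a finite proper initial segment $s$ of $Y$ such that $h$ is constant on the set of $Z\in[\omega]^{\omega}$ having $s$ as a proper initial segment. A quasi-order $Q$ is a better-quasi-order if there is no locally constant $h:[\omega]^{\omega}\to Q$ with $h(N)\not\leq h(N\setminus\{\min N\})$ for all $N\in[\omega]^{\omega}$. -}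

module Defs where

open import Level using (0ℓ)
open import Data.Nat using (ℕ; zero; suc; _≤_; _<_; s≤s; z≤n)
open import Data.Nat.Properties using (<-trans; m≤n⇒m<n∨m≡n)
open import Data.Product using (Σ; ∃; ∃-syntax; _,_; proj₁; proj₂; _×_)
open import Data.Sum using (inj₁; inj₂)
open import Data.Empty using (⊥)
open import Relation.Nullary using (¬_)
open import Relation.Binary.PropositionalEquality using (_≡_; refl; subst)
open import Relation.Binary.Structures using (IsPreorder)

StrictlyIncreasing : (ℕ → ℕ) → Set
StrictlyIncreasing f = ∀ i → f i < f (suc i)

ℰ : Set
ℰ = Σ (ℕ → ℕ) StrictlyIncreasing

inc-mono : ∀ (f : ℕ → ℕ) → StrictlyIncreasing f → ∀ {a b} → a < b → f a < f b
inc-mono f inc {a} {suc b} (s≤s a≤b) with m≤n⇒m<n∨m≡n a≤b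
... | inj₁ a<b = <-trans (inc-mono f inc a<b) (inc b)
... | inj₂ refl = inc b

_∘ℰ_ : ℰ → ℰ → ℰ
(h , hi) ∘ℰ (f , fi) = (λ i → h (f i)) , (λ i → inc-mono h hi (fi i))

-- Locally constant map ℰ → Q (continuous w.r.t. the Baire topology and the
-- discrete topology on Q): every f has a basic neighbourhood
-- {g : g i = f i for all i < n} on which φ is constant.
LocallyConstantℰ : {Q : Set} → (ℰ → Q) → Set
LocallyConstantℰ φ =
  ∀ (f : ℰ) → ∃[ n ] ∀ (g : ℰ) → (∀ i → i < n → proj₁ g i ≡ proj₁ f i) → φ g ≡ φ f

-- [ω]^ω: an infinite subset of ω is represented by its (unique) strictly
-- increasing enumeration N = {N 0 < N 1 < N 2 < ...}.
[ω]^ω : Set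
[ω]^ω = Σ (ℕ → ℕ) StrictlyIncreasing

-- The finite proper initial segments of Y are exactly {Y 0, ..., Y (k-1)}, k ∈ ℕ;
-- such a segment s is a proper initial segment of Z iff Z i = Y i for all i < k.
-- h is locally constant iff for every Y there is such s with h constant on
-- {Z : s is a proper initial segment of Z}.
LocallyConstant[ω]^ω : {Q : Set} → ([ω]^ω → Q) → Set
LocallyConstant[ω]^ω h =
  ∀ (Y : [ω]^ω) → ∃[ k ] ∀ (Z W : [ω]^ω)
    → (∀ i → i < k → proj₁ Z i ≡ proj₁ Y i)
    → (∀ i → i < k → proj₁ W i ≡ proj₁ Y i)
    → h Z ≡ h W

dropMin : [ω]^ω → [ω]^ω
dropMin (N , inc) = (λ i → N (suc i)) , (λ i → inc (suc i))

IsBQO : {Q : Set} → (Q → Q → Set) → Set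
IsBQO {Q} _≤Q_ =
  ¬ (Σ ([ω]^ω → Q) λ h → LocallyConstant[ω]^ω h × (∀ N → ¬ (h N ≤Q h (dropMin N))))

module Submission where

-- Fix g ∈ ℰ and colour Y ∈ ℰ by whether φ Y ≤ φ (Y ∘ g).  This colouring is
-- locally constant, so by the Galvin–Prikry theorem for ℰ every X ∈ ℰ has a
-- subsequence X ∘ K all of whose subsequences X ∘ K ∘ f get the same colour.  If
-- that colour were "≰", a continuous T : [ω]^ω → ℰ with T (N ∖ {min N}) = T N ∘ g
-- would make N ↦ φ (X ∘ K ∘ T N) a locally constant bad map, contradicting the
-- better-quasi-order hypothesis.  So every X has a subsequence good for g;
-- goodness passes to subsequences, and iterating over the finite list 𝒢 from the
-- identity gives h.
--
-- Excluded middle is used for the pigeonhole principle, the bar lemma, membership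
-- in the image of g, and comparisons in Q.

open import Defs
open import Level using (0ℓ)
open import Axiom.ExcludedMiddle using (ExcludedMiddle)
open import Axiom.DoubleNegationElimination using (em⇒dne)
open import Data.Bool using (Bool; true; false; if_then_else_)
open import Data.Bool.Properties using (¬-not)
open import Data.Empty using (⊥; ⊥-elim)
open import Data.List using (List; []; _∷_)
open import Data.List.Membership.Propositional using (_∈_)
open import Data.List.Relation.Unary.Any using (here; there)
open import Data.Nat using (ℕ; zero; suc; _+_; _∸_; _≤_; _<_; s≤s; z≤n; z<s; _≤?_; _≟_)
open import Data.Nat.Induction using (<-rec)
open import Data.Nat.Properties
open import Data.Product using (Σ; ∃-syntax; _,_; proj₁; proj₂; _×_)
open import Data.Sum using (inj₁; inj₂)
open import Function using (_∘_)
open import Relation.Binary.Definitions using (tri<; tri≈; tri>)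
open import Relation.Binary.PropositionalEquality
  using (_≡_; _≢_; refl; sym; trans; cong; cong₂; subst; subst₂; module ≡-Reasoning)
open import Relation.Binary.Structures using (IsPreorder)
open import Relation.Nullary using (¬_; Dec; yes; no; does; proof)
open import Relation.Nullary.Reflects using (invert)

EM : Set₁
EM = ExcludedMiddle 0ℓ

does-reflects : {P : Set} (d : Dec P) {b : Bool} → does d ≡ b → if b then P else ¬ P
does-reflects d refl = invert (proof d)

infix 4 _≈ₑ_
_≈ₑ_ : ℰ → ℰ → Set
A ≈ₑ B = ∀ i → proj₁ A i ≡ proj₁ B i

Respects≈ : {Q : Set} → (ℰ → Q) → Set
Respects≈ c = ∀ Y Z → Y ≈ₑ Z → c Y ≡ c Z

locallyConstant⇒respects : {Q : Set} (c : ℰ → Q) → LocallyConstantℰ c → Respects≈ c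
locallyConstant⇒respects c lc Y Z Y≈Z = proj₂ (lc Z) Y (λ i _ → Y≈Z i)

idℰ : ℰ
idℰ = (λ i → i) , (λ i → ≤-refl)

∘ℰ-assoc : ∀ X K f → (X ∘ℰ K) ∘ℰ f ≈ₑ X ∘ℰ (K ∘ℰ f)
∘ℰ-assoc X K f i = refl

inc-mono-≤ : ∀ (f : ℕ → ℕ) → StrictlyIncreasing f → ∀ {a b} → a ≤ b → f a ≤ f b
inc-mono-≤ f inc a≤b with m≤n⇒m<n∨m≡n a≤b
... | inj₁ a<b = <⇒≤ (inc-mono f inc a<b)
... | inj₂ refl = ≤-refl

inc-above-id : ∀ (f : ℕ → ℕ) → StrictlyIncreasing f → ∀ i → i ≤ f i
inc-above-id f inc zero = z≤n
inc-above-id f inc (suc i) = ≤-trans (s≤s (inc-above-id f inc i)) (inc i)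

inc-injective : ∀ (f : ℕ → ℕ) → StrictlyIncreasing f → ∀ {a b} → f a ≡ f b → a ≡ b
inc-injective f inc {a} {b} eq with <-cmp a b
... | tri< a<b _ _ = ⊥-elim (<-irrefl eq (inc-mono f inc a<b))
... | tri≈ _ a≡b _ = a≡b
... | tri> _ _ b<a = ⊥-elim (<-irrefl (sym eq) (inc-mono f inc b<a))

head<tail : ∀ (A : ℰ) j → proj₁ A 0 < proj₁ A (suc j)
head<tail A j = inc-mono (proj₁ A) (proj₂ A) z<s

infix 4 _∈ₑ_
_∈ₑ_ : ℕ → ℰ → Set
x ∈ₑ A = Σ ℕ λ j → proj₁ A j ≡ x

factor : (A Z : ℰ) → (∀ j → proj₁ Z j ∈ₑ A) → Σ ℰ λ f → A ∘ℰ f ≈ₑ Z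
factor A Z mem = (position , position-inc) , (λ j → proj₂ (mem j))
  where
  position : ℕ → ℕ
  position j = proj₁ (mem j)

  position-inc : StrictlyIncreasing position
  position-inc j with position (suc j) ≤? position j
  ... | no ≰ = ≰⇒> ≰
  ... | yes ≤ = ⊥-elim (<⇒≱ (proj₂ Z j)
          (subst₂ _≤_ (proj₂ (mem (suc j))) (proj₂ (mem j))
                  (inc-mono-≤ (proj₁ A) (proj₂ A) ≤)))

pigeonhole : EM → (b : ℕ → Bool) → Σ ℰ λ E → Σ Bool λ colour → ∀ j → b (proj₁ E j) ≡ colour
pigeonhole em b with em {Σ ℕ λ i → ∀ j → i ≤ j → b j ≡ false}
... | yes (i , false-from-i) =
  ((i +_) , λ j → +-monoʳ-< i (n<1+n j)) , false , λ j → false-from-i (i + j) (m≤m+n i j)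
... | no ¬eventually-false = (E , E-inc) , true , E-true
  where
  true-beyond : ∀ i → Σ ℕ λ j → i ≤ j × b j ≡ true
  true-beyond i = em⇒dne em λ none →
    ¬eventually-false (i , λ j i≤j → ¬-not λ bj → none (j , i≤j , bj))

  E : ℕ → ℕ
  E zero = proj₁ (true-beyond 0)
  E (suc k) = proj₁ (true-beyond (suc (E k)))

  E-inc : StrictlyIncreasing E
  E-inc k = proj₁ (proj₂ (true-beyond (suc (E k))))

  E-true : ∀ j → b (E j) ≡ true
  E-true zero = proj₂ (proj₂ (true-beyond 0))
  E-true (suc k) = proj₂ (proj₂ (true-beyond (suc (E k))))

prependF : ℕ → (ℕ → ℕ) → ℕ → ℕ
prependF a Y zero = a
prependF a Y (suc j) = a + suc (Y j)

prepend : ℕ → ℰ → ℰ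
prepend a (Y , Y-inc) = prependF a Y , inc
  where
  inc : StrictlyIncreasing (prependF a Y)
  inc zero = m<m+n a z<s
  inc (suc j) = +-monoʳ-< a (s≤s (Y-inc j))

respects-prepend : {c : ℰ → Bool} → Respects≈ c → ∀ a → Respects≈ (c ∘ prepend a)
respects-prepend c-resp a Y Z Y≈Z = c-resp (prepend a Y) (prepend a Z) same
  where
  same : prepend a Y ≈ₑ prepend a Z
  same zero = refl
  same (suc j) = cong (λ y → a + suc y) (Y≈Z j)

-- Decided c: c becomes constant after reading finitely many heads, i.e. the
-- well-founded tree of prefixes on which c is not yet constant.
data Decided (c : ℰ → Bool) : Set where
  constant : (∀ Y Z → c Y ≡ c Z) → Decided c
  branch   : (∀ a → Decided (c ∘ prepend a)) → Decided c

-- Classically, an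
-- undecided colouring has an undecided branch; following undecided branches
-- forever produces one sequence X, and local constancy of c at X makes some
-- node of this path constant, i.e. decided.
module BarLemma (em : EM) where

  Undecided : Set
  Undecided = Σ (ℰ → Bool) λ d → ¬ Decided d

  undecided-branch : ((c , _) : Undecided) → Σ ℕ λ a → ¬ Decided (c ∘ prepend a)
  undecided-branch (c , ¬dec) = em⇒dne em λ all-decided →
    ¬dec (branch λ a → em⇒dne em λ ¬dec-a → all-decided (a , ¬dec-a))

  undecided-child : Undecided → Undecided
  undecided-child u = proj₁ u ∘ prepend (proj₁ (undecided-branch u)) , proj₂ (undecided-branch u)

  module UndecidedPath (c : ℰ → Bool) (¬dec : ¬ Decided c) where

    node : ℕ → Undecided
    node zero = c , ¬dec
    node (suc n) = undecided-child (node n)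

    label : ℕ → ℕ
    label n = proj₁ (undecided-branch (node n))

    -- offset n: the amount by which the part of the path below depth n lifts the rest
    offset : ℕ → ℕ
    offset zero = 0
    offset (suc n) = suc (offset n + label n)

    path : ℰ
    path = (λ n → offset n + label n) , (λ n → s≤s (m≤m+n _ (label (suc n))))

    graft : ℕ → ℰ → ℰ
    graft zero Y = Y
    graft (suc n) Y = graft n (prepend (label n) Y)

    node-graft : ∀ n Y → proj₁ (node n) Y ≡ c (graft n Y)
    node-graft zero Y = refl
    node-graft (suc n) Y = node-graft n (prepend (label n) Y)

    graft-shape : ∀ n Y → (∀ j → j < n → proj₁ (graft n Y) j ≡ proj₁ path j)
                        × (∀ k → proj₁ (graft n Y) (n + k) ≡ offset n + proj₁ Y k)
    graft-shape zero Y = (λ j ()) , (λ k → refl)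
    graft-shape (suc n) Y = below , above
      where
      Y′ : ℰ
      Y′ = prepend (label n) Y

      shape : (∀ j → j < n → proj₁ (graft n Y′) j ≡ proj₁ path j)
            × (∀ k → proj₁ (graft n Y′) (n + k) ≡ offset n + proj₁ Y′ k)
      shape = graft-shape n Y′

      below : ∀ j → j < suc n → proj₁ (graft n Y′) j ≡ proj₁ path j
      below j (s≤s j≤n) with m≤n⇒m<n∨m≡n j≤n
      ... | inj₁ j<n = proj₁ shape j j<n
      ... | inj₂ refl =
        subst (λ u → proj₁ (graft n Y′) u ≡ proj₁ path j) (+-identityʳ j) (proj₂ shape 0)

      above : ∀ k → proj₁ (graft n Y′) (suc n + k) ≡ offset (suc n) + proj₁ Y k
      above k = begin
        proj₁ (graft n Y′) (suc n + k)                  ≡⟨ cong (proj₁ (graft n Y′)) (sym (+-suc n k)) ⟩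
        proj₁ (graft n Y′) (n + suc k)                  ≡⟨ proj₂ shape (suc k) ⟩
        offset n + (label n + suc (proj₁ Y k))          ≡⟨ sym (+-assoc (offset n) (label n) _) ⟩
        offset n + label n + suc (proj₁ Y k)            ≡⟨ +-suc (offset n + label n) _ ⟩
        offset (suc n) + proj₁ Y k                      ∎
        where open ≡-Reasoning

    -- local constancy at the path makes the node at the depth of its modulus constant
    contradiction : LocallyConstantℰ c → ⊥
    contradiction lc = proj₂ (node n) (constant λ Y Z → trans (value Y) (sym (value Z)))
      where
      n : ℕ
      n = proj₁ (lc path)
      value : ∀ Y → proj₁ (node n) Y ≡ c path
      value Y = trans (node-graft n Y) (proj₂ (lc path) (graft n Y) (proj₁ (graft-shape n Y)))

  bar : (c : ℰ → Bool) → LocallyConstantℰ c → Decided c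
  bar c lc = em⇒dne em λ ¬dec → UndecidedPath.contradiction c ¬dec lc

open BarLemma using (bar)

Homogeneous : (ℰ → Bool) → ℰ → Set
Homogeneous c M = Σ ℰ λ K → Σ Bool λ b → ∀ f → c ((M ∘ℰ K) ∘ℰ f) ≡ b

-- For A ∈ ℰ let next A be the
-- part of the tail of A picked out by a homogeneous subsequence for the branch
-- at the head of A; then c takes one colour on every subsequence of A that
-- starts with the head of A and continues inside next A.
-- Iterating next from M gives a fusion sequence whose heads, thinned out by the
-- pigeonhole principle to equally coloured ones, form the homogeneous subsequence.
module BranchStep (em : EM) (c : ℰ → Bool) (c-resp : Respects≈ c)
                  (homogeneous-branch : ∀ a M → Homogeneous (c ∘ prepend a) M) where

  -- the tail of A, shifted down so that prepend (head A) undoes it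
  shiftedTail : ℰ → ℰ
  shiftedTail A = (λ j → proj₁ A (suc j) ∸ suc (proj₁ A 0)) ,
                  (λ j → ∸-monoˡ-< (proj₂ A (suc j)) (head<tail A j))

  branchAt : (A : ℰ) → Homogeneous (c ∘ prepend (proj₁ A 0)) (shiftedTail A)
  branchAt A = homogeneous-branch (proj₁ A 0) (shiftedTail A)

  colour : ℰ → Bool
  colour A = proj₁ (proj₂ (branchAt A))

  next : ℰ → ℰ
  next A = A ∘ℰ ((λ j → suc (proj₁ K j)) , (λ j → s≤s (proj₂ K j)))
    where
    K : ℰ
    K = proj₁ (branchAt A)

  settled : ∀ A (Z f : ℰ) → proj₁ Z 0 ≡ proj₁ A 0
          → (∀ j → proj₁ Z (suc j) ≡ proj₁ (next A) (proj₁ f j)) → c Z ≡ colour A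
  settled A Z f Z-head Z-tail = trans (c-resp Z _ Z≈) (proj₂ (proj₂ (branchAt A)) f)
    where
    K : ℰ
    K = proj₁ (branchAt A)

    Z≈ : Z ≈ₑ prepend (proj₁ A 0) ((shiftedTail A ∘ℰ K) ∘ℰ f)
    Z≈ zero = Z-head
    Z≈ (suc j) = trans (Z-tail j)
      (sym (trans (+-suc (proj₁ A 0) _) (m+[n∸m]≡n (head<tail A (proj₁ K (proj₁ f j))))))

  module Fusion (M : ℰ) where

    fusion : ℕ → ℰ
    fusion zero = M
    fusion (suc i) = next (fusion i)

    head : ℕ → ℕ
    head i = proj₁ (fusion i) 0

    head-inc : StrictlyIncreasing head
    head-inc i = head<tail (fusion i) _

    fusion-shrinks-by : ∀ d p {x} → x ∈ₑ fusion (d + p) → x ∈ₑ fusion p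
    fusion-shrinks-by zero p m = m
    fusion-shrinks-by (suc d) p (j , e) =
      fusion-shrinks-by d p (suc (proj₁ (proj₁ (branchAt (fusion (d + p)))) j) , e)

    fusion-shrinks : ∀ {p q x} → p ≤ q → x ∈ₑ fusion q → x ∈ₑ fusion p
    fusion-shrinks {p} {q} {x} p≤q m =
      fusion-shrinks-by (q ∸ p) p (subst (λ r → x ∈ₑ fusion r) (sym (m∸n+n≡m p≤q)) m)

    homogeneous : Homogeneous c M
    homogeneous = K , colour₀ , stable
      where
      coloured : Σ ℰ λ E → Σ Bool λ b → ∀ j → colour (fusion (proj₁ E j)) ≡ b
      coloured = pigeonhole em (colour ∘ fusion)

      E : ℰ
      E = proj₁ coloured

      colour₀ : Bool
      colour₀ = proj₁ (proj₂ coloured)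

      selected : ℰ
      selected = head ∘ proj₁ E , λ j → inc-mono head head-inc (proj₂ E j)

      selected-in-M : Σ ℰ λ K → M ∘ℰ K ≈ₑ selected
      selected-in-M = factor M selected (λ j → fusion-shrinks {q = proj₁ E j} z≤n (0 , refl))

      K : ℰ
      K = proj₁ selected-in-M

      stable : ∀ f → c ((M ∘ℰ K) ∘ℰ f) ≡ colour₀
      stable f = trans (settled (fusion i) Z f′ (proj₂ selected-in-M (proj₁ f 0)) Z-tail)
                       (proj₂ (proj₂ coloured) (proj₁ f 0))
        where
        Z : ℰ
        Z = (M ∘ℰ K) ∘ℰ f

        i : ℕ
        i = proj₁ E (proj₁ f 0)

        tail-in-next : ∀ j → proj₁ Z (suc j) ∈ₑ fusion (suc i)
        tail-in-next j = fusion-shrinks (inc-mono (proj₁ E) (proj₂ E) (head<tail f j))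
                                        (0 , sym (proj₂ selected-in-M (proj₁ f (suc j))))

        tail-factor : Σ ℰ λ f′ → fusion (suc i) ∘ℰ f′ ≈ₑ dropMin Z
        tail-factor = factor (fusion (suc i)) (dropMin Z) tail-in-next

        f′ : ℰ
        f′ = proj₁ tail-factor

        Z-tail : ∀ j → proj₁ Z (suc j) ≡ proj₁ (next (fusion i)) (proj₁ f′ j)
        Z-tail j = sym (proj₂ tail-factor j)

decided⇒homogeneous : EM → (c : ℰ → Bool) → Respects≈ c → Decided c → ∀ M → Homogeneous c M
decided⇒homogeneous em c c-resp (constant same) M = idℰ , c M , λ f → same _ _
decided⇒homogeneous em c c-resp (branch decided) =
  BranchStep.Fusion.homogeneous em c c-resp
    (λ a → decided⇒homogeneous em (c ∘ prepend a) (respects-prepend c-resp a) (decided a))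

ramsey : EM → (c : ℰ → Bool) → LocallyConstantℰ c → ∀ M → Homogeneous c M
ramsey em c lc = decided⇒homogeneous em c (locallyConstant⇒respects c lc) (bar em c lc)

sumBelow : (ℕ → ℕ) → ℕ → ℕ
sumBelow f zero = 0
sumBelow f (suc n) = sumBelow f n + f n

sumFrom : (ℕ → ℕ) → ℕ → ℕ → ℕ
sumFrom f a zero = 0
sumFrom f a (suc n) = f a + sumFrom f (suc a) n

sumBelow-split : ∀ f a n → sumBelow f (a + n) ≡ sumBelow f a + sumFrom f a n
sumBelow-split f a zero = trans (cong (sumBelow f) (+-identityʳ a)) (sym (+-identityʳ _))
sumBelow-split f a (suc n) = begin
  sumBelow f (a + suc n)                          ≡⟨ cong (sumBelow f) (+-suc a n) ⟩
  sumBelow f (suc a + n)                          ≡⟨ sumBelow-split f (suc a) n ⟩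
  sumBelow f a + f a + sumFrom f (suc a) n        ≡⟨ +-assoc (sumBelow f a) (f a) _ ⟩
  sumBelow f a + sumFrom f a (suc n)              ∎
  where open ≡-Reasoning

sumFrom-cong : ∀ f f′ a n → (∀ t → a ≤ t → t < a + n → f t ≡ f′ t)
             → sumFrom f a n ≡ sumFrom f′ a n
sumFrom-cong f f′ a zero agree = refl
sumFrom-cong f f′ a (suc n) agree =
  cong₂ _+_ (agree a ≤-refl (m<m+n a z<s))
            (sumFrom-cong f f′ (suc a) n λ t a<t t<a+n →
              agree t (<⇒≤ a<t) (subst (t <_) (sym (+-suc a n)) t<a+n))

sumBelow-cong : ∀ f f′ n → (∀ t → t < n → f t ≡ f′ t) → sumBelow f n ≡ sumBelow f′ n
sumBelow-cong f f′ zero agree = refl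
sumBelow-cong f f′ (suc n) agree =
  cong₂ _+_ (sumBelow-cong f f′ n λ t t<n → agree t (m<n⇒m<1+n t<n)) (agree n ≤-refl)

record ShiftRealiser (g : ℰ) : Set where
  field
    T     : [ω]^ω → ℰ
    shift : ∀ N i → proj₁ (T (dropMin N)) i ≡ proj₁ (T N) (proj₁ g i)
    local : ∀ N Z x → (∀ j → j ≤ x → proj₁ N j ≡ proj₁ Z j) → proj₁ (T N) x ≡ proj₁ (T Z) x

-- T N is the sequence of partial sums of positive increments
-- step N x.  The points x ∈ ℕ are of three kinds: fixed points of g (an initial
-- segment of ℕ), images x = g i with i < x, and roots (not in the image of g).
-- T N (g i) = T N⁻ i (with N⁻ = N ∖ {min N}) forces, at an image point x = g i,
--     step N x = step N⁻ i − (sum of step N over the roots in the gap before x),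
-- while fixed points get step 1 and the root steps are free.  The root steps at
-- stage k = N 0 are chosen by the recursion `level k`, large enough that the
-- subtraction above stays positive; since N⁻ 0 > N 0 the increments of T N⁻
-- are at a later stage and dominate what stage N 0 needs (`step-large`).
module Realiser (em : EM) (g : ℰ) where

  γ : ℕ → ℕ
  γ = proj₁ g

  γ-inc : StrictlyIncreasing γ
  γ-inc = proj₂ g

  data View (x : ℕ) : Set where
    image : (i : ℕ) → γ i ≡ x → i < x → View x
    fixed : γ x ≡ x → View x
    root  : (∀ i → γ i ≢ x) → View x

  classify : (x : ℕ) → View x
  classify x with em {Σ ℕ λ i → γ i ≡ x}
  ... | no ∉image = root (λ i e → ∉image (i , e))
  ... | yes (i , e) with m≤n⇒m<n∨m≡n (subst (i ≤_) e (inc-above-id γ γ-inc i))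
  ...   | inj₁ i<x = image i e i<x
  ...   | inj₂ refl = fixed e

  gapStart : ℕ → ℕ
  gapStart zero = 0
  gapStart (suc i) = suc (γ i)

  gapStart≤ : ∀ i → gapStart i ≤ γ i
  gapStart≤ zero = z≤n
  gapStart≤ (suc i) = γ-inc i

  gapLen : ℕ → ℕ
  gapLen i = γ i ∸ gapStart i

  gapStart+gapLen : ∀ i → gapStart i + gapLen i ≡ γ i
  gapStart+gapLen i = m+[n∸m]≡n (gapStart≤ i)

  gap-root : ∀ i t → gapStart i ≤ t → t < γ i → ∀ j → γ j ≢ t
  gap-root i t start≤t t<γi j e with <-cmp j i
  ... | tri≈ _ refl _ = <-irrefl (sym e) t<γi
  ... | tri> _ _ i<j = <-irrefl (sym e) (<-trans t<γi (inc-mono γ γ-inc i<j))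
  gap-root (suc i) t start≤t t<γi j e | tri< (s≤s j≤i) _ _ =
    <-irrefl e (<-≤-trans (s≤s (inc-mono-≤ γ γ-inc j≤i)) start≤t)

  fixed-below : ∀ i → γ (suc i) ≡ suc i → γ i ≡ i
  fixed-below i e = ≤-antisym (≤-pred (subst (γ i <_) e (γ-inc i))) (inc-above-id γ γ-inc i)

  gapLen-fixed : ∀ x → γ x ≡ x → gapLen x ≡ 0
  gapLen-fixed zero e = e
  gapLen-fixed (suc i) e = trans (cong₂ _∸_ e (cong suc (fixed-below i e))) (n∸n≡0 (suc i))

  image-above : ∀ i → γ i ≢ i → i < γ i
  image-above i ≢ with m≤n⇒m<n∨m≡n (inc-above-id γ γ-inc i)
  ... | inj₁ i<γi = i<γi
  ... | inj₂ i≡γi = ⊥-elim (≢ (sym i≡γi))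

  -- Increment needed at γ i when the root steps are 1 + w: one step per root of
  -- the gap, plus a step exceeding w (γ i) unless i is a fixed point.
  fixedOr : (ℕ → ℕ) → ℕ → ℕ
  fixedOr w i with γ i ≟ i
  ... | yes _ = 0
  ... | no _ = w (γ i)

  need : (ℕ → ℕ) → ℕ → ℕ
  need w i = sumFrom (suc ∘ w) (gapStart i) (gapLen i) + suc (fixedOr w i)

  -- level k: the weights of the root steps at stage k
  level : ℕ → ℕ → ℕ
  level zero x = 0
  level (suc k) x = level k x + need (level k) x

  gapWeight : ℕ → ℕ → ℕ
  gapWeight k i = sumFrom (suc ∘ level k) (gapStart i) (gapLen i)

  need≤level : ∀ k k′ x → k < k′ → need (level k) x ≤ level k′ x
  need≤level k (suc k′) x (s≤s k≤k′) with m≤n⇒m<n∨m≡n k≤k′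
  ... | inj₁ k<k′ = ≤-trans (need≤level k k′ x k<k′) (m≤m+n (level k′ x) _)
  ... | inj₂ refl = m≤n+m (need (level k) x) (level k x)

  need-fixed : ∀ k x → γ x ≡ x → need (level k) x ≡ 1
  need-fixed k x e with γ x ≟ x
  ... | no ≢ = ⊥-elim (≢ e)
  ... | yes _ = cong (λ n → sumFrom (suc ∘ level k) (gapStart x) n + 1) (gapLen-fixed x e)

  need-image : ∀ k i → γ i ≢ i → need (level k) i ≡ gapWeight k i + suc (level k (γ i))
  need-image k i ≢ with γ i ≟ i
  ... | yes e = ⊥-elim (≢ e)
  ... | no _ = refl

  -- step N x, defined by recursion on the descent x = γ i, i < x, with fuel.
  mutual
    stepFuel : ℕ → (ℕ → ℕ) → ℕ → ℕ
    stepFuel zero N x = 0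
    stepFuel (suc n) N x = stepView n N x (classify x)

    stepView : ℕ → (ℕ → ℕ) → (x : ℕ) → View x → ℕ
    stepView n N x (image i _ _) = stepFuel n (N ∘ suc) i ∸ gapWeight (N 0) i
    stepView n N x (fixed _) = 1
    stepView n N x (root _) = suc (level (N 0) x)

  stepFuel-enough : ∀ n n′ N x → x < n → x < n′ → stepFuel n N x ≡ stepFuel n′ N x
  stepFuel-enough (suc n) (suc n′) N x (s≤s x≤n) (s≤s x≤n′) with classify x
  ... | image i _ i<x = cong (_∸ gapWeight (N 0) i)
          (stepFuel-enough n n′ (N ∘ suc) i (<-≤-trans i<x x≤n) (<-≤-trans i<x x≤n′))
  ... | fixed _ = refl
  ... | root _ = refl

  step : (ℕ → ℕ) → ℕ → ℕ
  step N x = stepFuel (suc x) N x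

  step-image : ∀ N i x → γ i ≡ x → i < x → step N x ≡ step (N ∘ suc) i ∸ gapWeight (N 0) i
  step-image N i x e i<x with classify x
  ... | image i′ e′ _ with inc-injective γ γ-inc (trans e′ (sym e))
  ...   | refl = cong (_∸ gapWeight (N 0) i) (stepFuel-enough x (suc i) (N ∘ suc) i i<x ≤-refl)
  step-image N i x e i<x | fixed e′ = ⊥-elim (<-irrefl (inc-injective γ γ-inc (trans e (sym e′))) i<x)
  step-image N i x e i<x | root ∉image = ⊥-elim (∉image i e)

  step-fixed : ∀ N x → γ x ≡ x → step N x ≡ 1
  step-fixed N x e with classify x
  ... | image i e′ i<x = ⊥-elim (<-irrefl (inc-injective γ γ-inc (trans e′ (sym e))) i<x)
  ... | fixed _ = refl
  ... | root ∉image = ⊥-elim (∉image x e)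

  step-root : ∀ N x → (∀ i → γ i ≢ x) → step N x ≡ suc (level (N 0) x)
  step-root N x ∉image with classify x
  ... | image i e _ = ⊥-elim (∉image i e)
  ... | fixed e = ⊥-elim (∉image x e)
  ... | root _ = refl

  -- The key invariant: steps are positive, and step M x covers what every
  -- earlier stage k < M 0 needs at x.
  Large : ℕ → Set
  Large x = ∀ M → StrictlyIncreasing M
          → 1 ≤ step M x × (∀ k → k < M 0 → need (level k) x ≤ step M x)

  step-large : ∀ x → Large x
  step-large = <-rec Large large
    where
    large : ∀ x → (∀ {y} → y < x → Large y) → Large x
    large x ih M M-inc = by-view (classify x)
      where
      covers : ∀ {s} → suc (level (M 0) x) ≤ s → ∀ k → k < M 0 → need (level k) x ≤ s
      covers bound k k<M0 = ≤-trans (≤-trans (need≤level k (M 0) x k<M0) (n≤1+n _)) bound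

      by-view : View x → 1 ≤ step M x × (∀ k → k < M 0 → need (level k) x ≤ step M x)
      by-view (root ∉image) rewrite step-root M x ∉image = s≤s z≤n , covers ≤-refl
      by-view (fixed e) rewrite step-fixed M x e = ≤-refl , (λ k _ → ≤-reflexive (need-fixed k x e))
      by-view (image i e i<x) rewrite step-image M i x e i<x = ≤-trans (s≤s z≤n) enough , covers enough
        where
        -- stage M 0 < M 1 is covered by the step of M⁻ at i
        covered : need (level (M 0)) i ≤ step (M ∘ suc) i
        covered = proj₂ (ih i<x (M ∘ suc) (M-inc ∘ suc)) (M 0) (M-inc 0)

        enough : suc (level (M 0) x) ≤ step (M ∘ suc) i ∸ gapWeight (M 0) i
        enough = m+n≤o⇒m≤o∸n _ (subst (_≤ step (M ∘ suc) i)
          (trans (need-image (M 0) i (λ γi≡i → <-irrefl (trans (sym γi≡i) e) i<x))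
                 (trans (cong (λ y → gapWeight (M 0) i + suc (level (M 0) y)) e)
                        (+-comm (gapWeight (M 0) i) _)))
          covered)

  step-positive : ∀ M → StrictlyIncreasing M → ∀ x → 1 ≤ step M x
  step-positive M M-inc x = proj₁ (step-large x M M-inc)

  gap-steps : ∀ M i → sumFrom (step M) (gapStart i) (gapLen i) ≡ gapWeight (M 0) i
  gap-steps M i = sumFrom-cong (step M) (suc ∘ level (M 0)) (gapStart i) (gapLen i)
    λ t start≤t t<end → step-root M t (gap-root i t start≤t (subst (t <_) (gapStart+gapLen i) t<end))

  gapWeight≤step : ∀ M → StrictlyIncreasing M → ∀ i → gapWeight (M 0) i ≤ step (M ∘ suc) i
  gapWeight≤step M M-inc i = ≤-trans (m≤m+n _ _)
    (proj₂ (step-large i (M ∘ suc) (M-inc ∘ suc)) (M 0) (M-inc 0))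

  realise : (ℕ → ℕ) → ℕ → ℕ
  realise N x = sumBelow (step N) (suc x)

  realise-inc : ∀ N → StrictlyIncreasing N → StrictlyIncreasing (realise N)
  realise-inc N N-inc x = subst (realise N x <_) (+-comm (step N (suc x)) (realise N x))
                                (m<n+m (realise N x) (step-positive N N-inc (suc x)))

  -- realise N ∘ γ = realise N⁻: summing up to γ i splits into the sums up to the
  -- previous image point, over the gap, and the step at γ i.
  realise-shift : ∀ N → StrictlyIncreasing N → ∀ i → realise N (γ i) ≡ realise (N ∘ suc) i
  realise-shift N N-inc i = begin
    realise N (γ i)                                                          ≡⟨ split ⟩
    sumBelow (step N) (gapStart i) + sumFrom (step N) (gapStart i) (gapLen i) + step N (γ i)
      ≡⟨ cong₂ (λ a b → a + b + step N (γ i)) (before i) (gap-steps N i) ⟩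
    sumBelow (step (N ∘ suc)) i + gapWeight (N 0) i + step N (γ i)           ≡⟨ last (γ i ≟ i) ⟩
    realise (N ∘ suc) i                                                      ∎
    where
    open ≡-Reasoning
    split : realise N (γ i)
          ≡ sumBelow (step N) (gapStart i) + sumFrom (step N) (gapStart i) (gapLen i) + step N (γ i)
    split = cong (_+ step N (γ i)) (trans (cong (sumBelow (step N)) (sym (gapStart+gapLen i)))
                                          (sumBelow-split (step N) (gapStart i) (gapLen i)))

    before : ∀ i → sumBelow (step N) (gapStart i) ≡ sumBelow (step (N ∘ suc)) i
    before zero = refl
    before (suc i) = realise-shift N N-inc i

    last : Dec (γ i ≡ i)
         → sumBelow (step (N ∘ suc)) i + gapWeight (N 0) i + step N (γ i) ≡ realise (N ∘ suc) i
    last (yes e) rewrite gapLen-fixed i e | e | step-fixed N i e | step-fixed (N ∘ suc) i e =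
      cong (_+ 1) (+-identityʳ _)
    last (no ≢) = trans (+-assoc (sumBelow (step (N ∘ suc)) i) _ _)
      (cong (sumBelow (step (N ∘ suc)) i +_)
        (trans (cong (gapWeight (N 0) i +_) (step-image N i (γ i) refl (image-above i ≢)))
               (m+[n∸m]≡n (gapWeight≤step N N-inc i))))

  step-local : ∀ x N Z → (∀ j → j ≤ x → N j ≡ Z j) → step N x ≡ step Z x
  step-local = <-rec Local local
    where
    Local : ℕ → Set
    Local x = ∀ N Z → (∀ j → j ≤ x → N j ≡ Z j) → step N x ≡ step Z x

    local : ∀ x → (∀ {y} → y < x → Local y) → Local x
    local x ih N Z agree = by-view (classify x)
      where
      by-view : View x → step N x ≡ step Z x
      by-view (root ∉image) rewrite step-root N x ∉image | step-root Z x ∉image | agree 0 z≤n = refl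
      by-view (fixed e) rewrite step-fixed N x e | step-fixed Z x e = refl
      by-view (image i e i<x) rewrite step-image N i x e i<x | step-image Z i x e i<x | agree 0 z≤n =
        cong (_∸ gapWeight (Z 0) i)
             (ih i<x (N ∘ suc) (Z ∘ suc) λ j j≤i → agree (suc j) (<-≤-trans (s≤s j≤i) i<x))

  realise-local : ∀ N Z x → (∀ j → j ≤ x → N j ≡ Z j) → realise N x ≡ realise Z x
  realise-local N Z x agree = sumBelow-cong (step N) (step Z) (suc x)
    λ t t<1+x → step-local t N Z λ j j≤t → agree j (≤-trans j≤t (≤-pred t<1+x))

shiftRealiser : EM → (g : ℰ) → ShiftRealiser g
shiftRealiser em g = record
  { T     = λ N → realise (proj₁ N) , realise-inc (proj₁ N) (proj₂ N)
  ; shift = λ N i → sym (realise-shift (proj₁ N) (proj₂ N) i)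
  ; local = λ N Z → realise-local (proj₁ N) (proj₁ Z)
  }
  where open Realiser em g

module Goodness {Q : Set} (_≤Q_ : Q → Q → Set) (φ : ℰ → Q) (φ-lc : LocallyConstantℰ φ) where

  φ-resp : Respects≈ φ
  φ-resp = locallyConstant⇒respects φ φ-lc

  Good : ℰ → ℰ → Set
  Good g X = ∀ f → φ (X ∘ℰ f) ≤Q φ ((X ∘ℰ f) ∘ℰ g)

  good-resp : ∀ {g X Y} → X ≈ₑ Y → Good g X → Good g Y
  good-resp {g} X≈Y good f = subst₂ _≤Q_ (φ-resp _ _ λ i → X≈Y (proj₁ f i))
                                         (φ-resp _ _ λ i → X≈Y (proj₁ f (proj₁ g i))) (good f)

  good-sub : ∀ {g X} K → Good g X → Good g (X ∘ℰ K)
  good-sub K good f = subst₂ _≤Q_ (φ-resp _ _ λ i → refl) (φ-resp _ _ λ i → refl) (good (K ∘ℰ f))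

  -- A better-quasi-order admits no X on all of whose subsequences Y one has
  -- φ Y ≰ φ (Y ∘ g): composing with a realiser of g, N ↦ φ (X ∘ T N) would be a
  -- locally constant bad map.
  no-bad-homogeneous : IsBQO _≤Q_ → ∀ g X → ShiftRealiser g
                     → ¬ (∀ f → ¬ φ (X ∘ℰ f) ≤Q φ ((X ∘ℰ f) ∘ℰ g))
  no-bad-homogeneous bqo g X realiser bad = bqo (h , h-lc , h-bad)
    where
    open ShiftRealiser realiser

    h : [ω]^ω → Q
    h N = φ (X ∘ℰ T N)

    h-lc : LocallyConstant[ω]^ω h
    h-lc Y = n , λ Z W Z-agree W-agree → trans (near Z Z-agree) (sym (near W W-agree))
      where
      n : ℕ
      n = proj₁ (φ-lc (X ∘ℰ T Y))

      near : ∀ Z → (∀ i → i < n → proj₁ Z i ≡ proj₁ Y i) → h Z ≡ h Y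
      near Z agree = proj₂ (φ-lc (X ∘ℰ T Y)) (X ∘ℰ T Z) λ i i<n →
        cong (proj₁ X) (local Z Y i λ j j≤i → agree j (≤-<-trans j≤i i<n))

    h-bad : ∀ N → ¬ (h N ≤Q h (dropMin N))
    h-bad N h≤ = bad (T N) (subst (h N ≤Q_) (φ-resp _ _ λ i → cong (proj₁ X) (shift N i)) h≤)

  module _ (em : EM) (bqo : IsBQO _≤Q_) where

    comparison : ℰ → ℰ → Bool
    comparison g Y = does (em {φ Y ≤Q φ (Y ∘ℰ g)})

    comparison-lc : ∀ g → LocallyConstantℰ (comparison g)
    comparison-lc g X = n₁ + proj₁ g n₂ , λ Y agree →
      cong₂ (λ p q → does (em {p ≤Q q}))
        (modulus₁ Y λ i i<n₁ → agree i (≤-trans i<n₁ (m≤m+n n₁ _)))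
        (modulus₂ (Y ∘ℰ g) λ i i<n₂ →
          agree (proj₁ g i) (≤-trans (inc-mono (proj₁ g) (proj₂ g) i<n₂) (m≤n+m _ n₁)))
      where
      n₁ : ℕ
      n₁ = proj₁ (φ-lc X)

      modulus₁ : ∀ Y → (∀ i → i < n₁ → proj₁ Y i ≡ proj₁ X i) → φ Y ≡ φ X
      modulus₁ = proj₂ (φ-lc X)

      n₂ : ℕ
      n₂ = proj₁ (φ-lc (X ∘ℰ g))

      modulus₂ : ∀ Y → (∀ i → i < n₂ → proj₁ Y i ≡ proj₁ (X ∘ℰ g) i) → φ Y ≡ φ (X ∘ℰ g)
      modulus₂ = proj₂ (φ-lc (X ∘ℰ g))

    good-subsequence : ∀ g X → Σ ℰ λ K → Good g (X ∘ℰ K)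
    good-subsequence g X with ramsey em (comparison g) (comparison-lc g) X
    ... | K , true , homogeneous = K , λ f → does-reflects em (homogeneous f)
    ... | K , false , homogeneous = ⊥-elim (no-bad-homogeneous bqo g (X ∘ℰ K) (shiftRealiser em g)
                                              λ f → does-reflects em (homogeneous f))

    good-for-all : ∀ 𝒢 X → Σ ℰ λ K → ∀ g → g ∈ 𝒢 → Good g (X ∘ℰ K)
    good-for-all [] X = idℰ , λ g ()
    good-for-all (g ∷ 𝒢) X = K₁ ∘ℰ K₂ , good
      where
      K₁ : ℰ
      K₁ = proj₁ (good-subsequence g X)

      K₂ : ℰ
      K₂ = proj₁ (good-for-all 𝒢 (X ∘ℰ K₁))

      good : ∀ g′ → g′ ∈ g ∷ 𝒢 → Good g′ (X ∘ℰ (K₁ ∘ℰ K₂))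
      good g′ (here refl) =
        good-resp (∘ℰ-assoc X K₁ K₂) (good-sub K₂ (proj₂ (good-subsequence g X)))
      good g′ (there g′∈𝒢) =
        good-resp (∘ℰ-assoc X K₁ K₂) (proj₂ (good-for-all 𝒢 (X ∘ℰ K₁)) g′ g′∈𝒢)

proposition4p13 : ExcludedMiddle 0ℓ
    → {Q : Set} (_≤Q_ : Q → Q → Set) → IsPreorder _≡_ _≤Q_ → IsBQO _≤Q_
    → (φ : ℰ → Q) → LocallyConstantℰ φ
    → (𝒢 : List ℰ)
    → ∃[ h ] ∀ (f g : ℰ) → g ∈ 𝒢 → φ (h ∘ℰ f) ≤Q φ ((h ∘ℰ f) ∘ℰ g)
proposition4p13 em _≤Q_ _ bqo φ φ-lc 𝒢 = idℰ ∘ℰ K , λ f g g∈𝒢 → good g g∈𝒢 f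
  where
  open Goodness _≤Q_ φ φ-lc

  K : ℰ
  K = proj₁ (good-for-all em bqo 𝒢 idℰ)

  good : ∀ g → g ∈ 𝒢 → Good g (idℰ ∘ℰ K)
  good = proj₂ (good-for-all em bqo 𝒢 idℰ)
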